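{- $\mathbf{P}$ is not a unique factorisation semiring: there is a profile admitting two factorisations into irreducible profiles (different from $(1)$) that are not rearrangements of one another.
   Context: A profile is a sequence $\mathbf{p}=(p_i)_{i\in\mathbb{N}}$ of natural numbers for which there exists $h\ge -1$ with $p_i\ge 1$ for $0\le i\le h$ and $p_i=0$ for $i>h$ (the null sequence $(0)$ is a profile); it is written as the finite sequence of its nonzero terms. $\mathbf{P}$ is the set of profiles, a commutative semiring with elementwise sum and product $(\mathbf{p}\times\mathbf{q})_i = p_i\sum_{j=0}^i q_j + q_i\sum_{j=0}^i p_j - p_i q_i$, with one $(1)=(1,0,0,\ldots)$. A profile $\mathbf{p}$ is irreducible if whenever $\mathbf{p}=\mathbf{q}\times\mathbf{r}$, one of $\mathbf{q},\mathbf{r}$ equals $(1)$. -}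

module Defs where

open import Data.Nat using (ℕ; zero; suc; _+_; _*_; _∸_; _≤_)
open import Data.List using (List; []; _∷_; map; foldr)
open import Data.List.Relation.Unary.All using (All)
open import Data.Sum using (_⊎_)
open import Relation.Binary.PropositionalEquality using (_≡_)

-- A profile, written (as in the paper) as the finite list of its nonzero terms.
record Profile : Set where
  constructor mkProfile
  field
    terms : List ℕ
    pos   : All (1 ≤_) terms
open Profile public

at : List ℕ → ℕ → ℕ
at []       _       = 0
at (x ∷ xs) zero    = x
at (x ∷ xs) (suc i) = at xs i

seq : Profile → ℕ → ℕ
seq p = at (terms p)

psum : (ℕ → ℕ) → ℕ → ℕ
psum f zero    = f zero
psum f (suc i) = psum f i + f (suc i)

_⊠_ : (ℕ → ℕ) → (ℕ → ℕ) → ℕ → ℕ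
(p ⊠ q) i = p i * psum q i + q i * psum p i ∸ p i * q i

oneSeq : ℕ → ℕ
oneSeq zero    = 1
oneSeq (suc _) = 0

_≐_ : (ℕ → ℕ) → (ℕ → ℕ) → Set
f ≐ g = ∀ i → f i ≡ g i

prodSeq : List Profile → ℕ → ℕ
prodSeq = foldr (λ p acc → seq p ⊠ acc) oneSeq

Irreducible : Profile → Set
Irreducible p = ∀ (q r : Profile) → seq p ≐ (seq q ⊠ seq r) →
  (terms q ≡ 1 ∷ []) ⊎ (terms r ≡ 1 ∷ [])

-- For profiles q and r, (q × r)₀ = q₀ r₀ and (q × r)₁ = q₁ (r₀ + r₁) + r₁ q₀, and a profile q
-- with q₀ = 1 and q₁ = 0 is (1). Hence if p₀ is prime and p₁ < p₀, or p₀ = 1 and p₁ < 3, then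
-- p is irreducible: one factor has leading term 1, and a nonzero second term in it would make
-- p₁ too large. This gives the irreducible profiles (1,1), (2), (3), (2,1), (3,1), and
-- (1,1) × (2) × (3) = (6,6) = (2,1) × (3,1) are two factorisations of different lengths.
module Submission where

open import Defs
open import Data.Nat using (zero; suc; _+_; _*_; _∸_; _≤_; _<_; s≤s; z<s; s<s)
open import Data.Nat.Properties
open import Data.Nat.Divisibility using (_∣_; m∣m*n)
open import Data.Nat.Primality using (Prime; prime?; prime[2]; prime⇒irreducible; prime⇒nonZero)
open import Data.List using (List; []; _∷_; map)
open import Data.List.Relation.Unary.All using (All; []; _∷_)
open import Data.List.Relation.Binary.Permutation.Propositional using (_↭_)
open import Data.List.Relation.Binary.Permutation.Propositional.Properties using (↭-length)
open import Data.Product using (Σ; _×_; _,_)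
open import Data.Sum using (_⊎_; inj₁; inj₂) renaming (map to ⊎-map)
open import Relation.Nullary using (¬_; contradiction)
open import Relation.Nullary.Decidable using (from-yes)
open import Relation.Binary.PropositionalEquality

⊠-comm : ∀ f g → (f ⊠ g) ≐ (g ⊠ f)
⊠-comm f g i = cong₂ _∸_ (+-comm (f i * psum g i) (g i * psum f i)) (*-comm (f i) (g i))

⊠-zero : ∀ f g → (f ⊠ g) 0 ≡ f 0 * g 0
⊠-zero f g = trans (m+n∸m≡n (f 0 * g 0) (g 0 * f 0)) (*-comm (g 0) (f 0))

⊠-suc : ∀ f g k → (f ⊠ g) (suc k) ≡ f (suc k) * psum g (suc k) + g (suc k) * psum f k
⊠-suc f g k = begin
  x * S + y * (P + x) ∸ x * y     ≡⟨ cong (λ t → x * S + t ∸ x * y) (*-distribˡ-+ y P x) ⟩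
  x * S + (y * P + y * x) ∸ x * y ≡⟨ cong (λ t → x * S + (y * P + t) ∸ x * y) (*-comm y x) ⟩
  x * S + (y * P + x * y) ∸ x * y ≡⟨ cong (_∸ x * y) (sym (+-assoc (x * S) (y * P) (x * y))) ⟩
  x * S + y * P + x * y ∸ x * y   ≡⟨ m+n∸n≡m (x * S + y * P) (x * y) ⟩
  x * S + y * P                   ∎
  where
  open ≡-Reasoning
  x = f (suc k)
  y = g (suc k)
  S = psum g (suc k)
  P = psum f k

terms≡[1] : ∀ q → seq q 0 ≡ 1 → seq q 1 ≡ 0 → terms q ≡ 1 ∷ []
terms≡[1] (mkProfile (1 ∷ [])     _)             refl _ = refl
terms≡[1] (mkProfile (1 ∷ b ∷ _)  (_ ∷ 1≤b ∷ _)) refl b≡0 = contradiction (subst (1 ≤_) b≡0 1≤b) λ ()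

prime-factors : ∀ {m n p} → Prime p → m * n ≡ p → m ≡ 1 ⊎ n ≡ 1
prime-factors {m} {n} pp mn≡p with prime⇒irreducible pp (subst (m ∣_) mn≡p (m∣m*n n))
... | inj₁ m≡1 = inj₁ m≡1
... | inj₂ refl = inj₂ (*-cancelˡ-≡ n 1 m (trans mn≡p (sym (*-identityʳ m))))
  where instance _ = prime⇒nonZero pp

m*[n+o]+k<n⇒m≡0 : ∀ m n o k → m * (n + o) + k < n → m ≡ 0
m*[n+o]+k<n⇒m≡0 zero    n o k _ = refl
m*[n+o]+k<n⇒m≡0 (suc m) n o k lt = contradiction lt (≤⇒≯ n≤lhs)
  where
  n≤lhs : n ≤ suc m * (n + o) + k
  n≤lhs = ≤-trans (m≤m+n n o) (≤-trans (m≤m+n (n + o) (m * (n + o))) (m≤m+n _ k))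

m*[1+n]+n*1<3⇒m≡0⊎n≡0 : ∀ m n → m * (1 + n) + n * 1 < 3 → m ≡ 0 ⊎ n ≡ 0
m*[1+n]+n*1<3⇒m≡0⊎n≡0 zero    n       _ = inj₁ refl
m*[1+n]+n*1<3⇒m≡0⊎n≡0 (suc m) zero    _ = inj₂ refl
m*[1+n]+n*1<3⇒m≡0⊎n≡0 (suc m) (suc n) (s≤s (s≤s (s≤s lhs≤0))) =
  contradiction (n≤0⇒n≡0 lhs≤0) (m+1+n≢0 (n + m * suc (suc n)))

leading-unit-factor : ∀ p q r → seq p ≐ (seq q ⊠ seq r) → seq q 0 ≡ 1 →
  seq p 1 < seq p 0 → terms q ≡ 1 ∷ []
leading-unit-factor p q r p≐qr q₀≡1 p₁<p₀ =
  terms≡[1] q q₀≡1 (m*[n+o]+k<n⇒m≡0 (seq q 1) (seq r 0) (seq r 1) (seq r 1 * seq q 0) p₁<r₀)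
  where
  p₀≡r₀ : seq p 0 ≡ seq r 0
  p₀≡r₀ = trans (p≐qr 0) (trans (⊠-zero (seq q) (seq r)) (trans (cong (_* seq r 0) q₀≡1) (*-identityˡ (seq r 0))))
  p₁<r₀ : seq q 1 * (seq r 0 + seq r 1) + seq r 1 * seq q 0 < seq r 0
  p₁<r₀ = subst₂ _<_ (trans (p≐qr 1) (⊠-suc (seq q) (seq r) 0)) p₀≡r₀ p₁<p₀

prime-head-irreducible : ∀ p → Prime (seq p 0) → seq p 1 < seq p 0 → Irreducible p
prime-head-irreducible p pp p₁<p₀ q r p≐qr
  with prime-factors pp (sym (trans (p≐qr 0) (⊠-zero (seq q) (seq r))))
... | inj₁ q₀≡1 = inj₁ (leading-unit-factor p q r p≐qr q₀≡1 p₁<p₀)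
... | inj₂ r₀≡1 = inj₂ (leading-unit-factor p r q p≐rq r₀≡1 p₁<p₀)
  where
  p≐rq : seq p ≐ (seq r ⊠ seq q)
  p≐rq i = trans (p≐qr i) (⊠-comm (seq q) (seq r) i)

unit-head-irreducible : ∀ p → seq p 0 ≡ 1 → seq p 1 < 3 → Irreducible p
unit-head-irreducible p p₀≡1 p₁<3 q r p≐qr =
  ⊎-map (terms≡[1] q q₀≡1) (terms≡[1] r r₀≡1) (m*[1+n]+n*1<3⇒m≡0⊎n≡0 (seq q 1) (seq r 1) q₁r₁<3)
  where
  q₀r₀≡1 : seq q 0 * seq r 0 ≡ 1
  q₀r₀≡1 = trans (sym (trans (p≐qr 0) (⊠-zero (seq q) (seq r)))) p₀≡1
  q₀≡1 : seq q 0 ≡ 1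
  q₀≡1 = m*n≡1⇒m≡1 (seq q 0) (seq r 0) q₀r₀≡1
  r₀≡1 : seq r 0 ≡ 1
  r₀≡1 = m*n≡1⇒n≡1 (seq q 0) (seq r 0) q₀r₀≡1
  q₁r₁<3 : seq q 1 * (1 + seq r 1) + seq r 1 * 1 < 3
  q₁r₁<3 = subst (_< 3) (trans (p≐qr 1) (trans (⊠-suc (seq q) (seq r) 0)
    (cong₂ (λ a b → seq q 1 * (a + seq r 1) + seq r 1 * b) r₀≡1 q₀≡1))) p₁<3

⟨1,1⟩ ⟨2⟩ ⟨3⟩ ⟨2,1⟩ ⟨3,1⟩ ⟨6,6⟩ : Profile
⟨1,1⟩ = mkProfile (1 ∷ 1 ∷ []) (z<s ∷ z<s ∷ [])
⟨2⟩   = mkProfile (2 ∷ []) (z<s ∷ [])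
⟨3⟩   = mkProfile (3 ∷ []) (z<s ∷ [])
⟨2,1⟩ = mkProfile (2 ∷ 1 ∷ []) (z<s ∷ z<s ∷ [])
⟨3,1⟩ = mkProfile (3 ∷ 1 ∷ []) (z<s ∷ z<s ∷ [])
⟨6,6⟩ = mkProfile (6 ∷ 6 ∷ []) (z<s ∷ z<s ∷ [])

prime[3] : Prime 3
prime[3] = from-yes (prime? 3)

irreducible-⟨1,1⟩ : Irreducible ⟨1,1⟩
irreducible-⟨1,1⟩ = unit-head-irreducible ⟨1,1⟩ refl (s<s z<s)

irreducible-⟨2⟩ : Irreducible ⟨2⟩
irreducible-⟨2⟩ = prime-head-irreducible ⟨2⟩ prime[2] z<s

irreducible-⟨3⟩ : Irreducible ⟨3⟩
irreducible-⟨3⟩ = prime-head-irreducible ⟨3⟩ prime[3] z<s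

irreducible-⟨2,1⟩ : Irreducible ⟨2,1⟩
irreducible-⟨2,1⟩ = prime-head-irreducible ⟨2,1⟩ prime[2] (s<s z<s)

irreducible-⟨3,1⟩ : Irreducible ⟨3,1⟩
irreducible-⟨3,1⟩ = prime-head-irreducible ⟨3,1⟩ prime[3] (s<s z<s)

⟨6,6⟩≐⟨1,1⟩⟨2⟩⟨3⟩ : seq ⟨6,6⟩ ≐ prodSeq (⟨1,1⟩ ∷ ⟨2⟩ ∷ ⟨3⟩ ∷ [])
⟨6,6⟩≐⟨1,1⟩⟨2⟩⟨3⟩ 0             = refl
⟨6,6⟩≐⟨1,1⟩⟨2⟩⟨3⟩ 1             = refl
⟨6,6⟩≐⟨1,1⟩⟨2⟩⟨3⟩ (suc (suc _)) = refl

⟨6,6⟩≐⟨2,1⟩⟨3,1⟩ : seq ⟨6,6⟩ ≐ prodSeq (⟨2,1⟩ ∷ ⟨3,1⟩ ∷ [])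
⟨6,6⟩≐⟨2,1⟩⟨3,1⟩ 0             = refl
⟨6,6⟩≐⟨2,1⟩⟨3,1⟩ 1             = refl
⟨6,6⟩≐⟨2,1⟩⟨3,1⟩ (suc (suc _)) = refl

theorem4 : Σ Profile λ p → Σ (List Profile) λ fs → Σ (List Profile) λ gs →
    All Irreducible fs × All (λ f → terms f ≢ 1 ∷ []) fs ×
    All Irreducible gs × All (λ g → terms g ≢ 1 ∷ []) gs ×
    (seq p ≐ prodSeq fs) × (seq p ≐ prodSeq gs) ×
    ¬ (map terms fs ↭ map terms gs)
theorem4 = ⟨6,6⟩ , (⟨1,1⟩ ∷ ⟨2⟩ ∷ ⟨3⟩ ∷ []) , (⟨2,1⟩ ∷ ⟨3,1⟩ ∷ [])
  , (irreducible-⟨1,1⟩ ∷ irreducible-⟨2⟩ ∷ irreducible-⟨3⟩ ∷ [])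
  , ((λ ()) ∷ (λ ()) ∷ (λ ()) ∷ [])
  , (irreducible-⟨2,1⟩ ∷ irreducible-⟨3,1⟩ ∷ [])
  , ((λ ()) ∷ (λ ()) ∷ [])
  , ⟨6,6⟩≐⟨1,1⟩⟨2⟩⟨3⟩
  , ⟨6,6⟩≐⟨2,1⟩⟨3,1⟩
  , λ perm → contradiction (↭-length perm) λ ()
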